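{- As formal power series in $q$, \[ \sum_{n\geq 1} \frac{q^n}{1+q^n}\,\frac{1}{(q;q)_{n-1}} \;=\; \sum_{n\geq 1} \frac{q^{n(n+1)/2}}{(q^2;q^2)_n\,(q^{n+1};q)_\infty}. \]
   Context: For a non-negative integer $L$, $(a;q)_L=\prod_{i=0}^{L-1}(1-aq^i)$ (so $(a;q)_0=1$), and $(a;q)_\infty=\lim_{L\to\infty}(a;q)_L$. -}

module Defs where

open import Data.Nat as ℕ using (ℕ; zero; suc; _∸_)
open import Relation.Nullary using (yes; no)
open import Data.Nat.DivMod using (_/_)
open import Data.Integer using (ℤ; +_; _+_; _*_; -_; _-_)

-- Formal power series in q with integer coefficients: f n = coefficient of q^n.
PS : Set
PS = ℕ → ℤ

sumBelow : ℕ → (ℕ → ℤ) → ℤ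
sumBelow zero    f = + 0
sumBelow (suc n) f = sumBelow n f + f n

0ₚ : PS
0ₚ _ = + 0

1ₚ : PS
1ₚ zero    = + 1
1ₚ (suc _) = + 0

infixl 6 _⊕_ _⊖_
infixl 7 _⊛_

_⊕_ : PS → PS → PS
(f ⊕ g) n = f n + g n

_⊖_ : PS → PS → PS
(f ⊖ g) n = f n - g n

_⊛_ : PS → PS → PS
(f ⊛ g) n = sumBelow (suc n) (λ i → f i * g (n ∸ i))

qpow : ℕ → PS
qpow k n with k ℕ.≟ n
... | yes _ = + 1
... | no  _ = + 0

_^ₚ_ : PS → ℕ → PS
f ^ₚ zero  = 1ₚ
f ^ₚ suc k = f ⊛ (f ^ₚ k)

-- multiplicative inverse of a series with constant term 1:
-- 1/f = 1/(1 - h) = Σ_{k≥0} h^k with h = 1 - f (h has zero constant term,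
-- so only k ≤ n contribute to the coefficient of q^n).
inv : PS → PS
inv f n = sumBelow (suc n) (λ k → ((1ₚ ⊖ f) ^ₚ k) n)

_⊘_ : PS → PS → PS
f ⊘ g = f ⊛ inv g

prodBelow : ℕ → (ℕ → PS) → PS
prodBelow zero    F = 1ₚ
prodBelow (suc L) F = prodBelow L F ⊛ F L

poch : PS → PS → ℕ → PS
poch a b L = prodBelow L (λ i → 1ₚ ⊖ a ⊛ (b ^ₚ i))

-- (a;b)_∞ = lim_L (a;b)_L, for b with zero constant term: the factors with
-- i > n are ≡ 1 mod q^{n+1}, so the coefficient of q^n is that of (a;b)_{n+1}.
pochInf : PS → PS → PS
pochInf a b n = poch a b (suc n) n

-- Σ_{k≥1} F k for a family with F k of q-adic valuation ≥ k:
-- only k ≤ n contribute to the coefficient of q^n.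
sumFrom1 : (ℕ → PS) → PS
sumFrom1 F n = sumBelow n (λ j → F (suc j) n)

q : PS
q = qpow 1

lhsTerm : ℕ → PS
lhsTerm n = (qpow n ⊘ (1ₚ ⊕ qpow n)) ⊘ poch q q (n ∸ 1)

rhsTerm : ℕ → PS
rhsTerm n = qpow ((n ℕ.* suc n) / 2) ⊘ (poch (qpow 2) (qpow 2) n ⊛ pochInf (qpow (suc n)) q)

-- Multiply both sides by (q;q)_N and compare coefficients up to q^N.  On the left the n-th term
-- becomes q^n (q^n;q)_(N-n+1) / (1 + q^n).  On the right, (q^2;q^2)_n = (q;q)_n (-q;q)_n and
-- (q;q)_N ≡ (q;q)_n (q^(n+1);q)_∞ modulo q^(N+1), so the n-th term becomes q^(n(n+1)/2) / (-q;q)_n.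
-- Modulo q^(N+1) this may be multiplied by (q^(N-n+1);q)_n ≡ 1 (mod q^(N-n+1)), as n(n+1)/2 ≥ n;
-- with that factor the identity truncated at N becomes exact:
--
--   Σ_{n=1}^{N} q^n (q^n;q)_(N-n+1) / (1 + q^n)  =  Σ_{n=1}^{N} q^(n(n+1)/2) (q^(N-n+1);q)_n / (-q;q)_n
--
-- Both sides S_N satisfy S_(N+1) = (1 - q^(N+1)) (S_N + q^(N+1) / (1 + q^(N+1))): on the left
-- termwise, on the right after splitting the last factor of each Pochhammer symbol and using the
-- telescoping evaluation  Σ_{n=0}^{M-1} q^(n(n+1)/2) (q^(M-n);q)_n / (-q;q)_(n+1) = 1 / (1 + q^M)
-- for M ≥ 1.
-- All computations take place in ℤ[q]/(q^K), where the commutative ring solver applies.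

module Submission where

open import Defs
open import Data.Nat as ℕ using (ℕ; zero; suc; _∸_; z≤n; s≤s)
  renaming (_+_ to _+ℕ_; _≤_ to _≤ℕ_; _<_ to _<ℕ_)
import Data.Nat.Properties as ℕP
import Data.Nat.Tactic.RingSolver as ℕSolver
open import Data.Nat.DivMod using (_/_; m*n/n≡m)
open import Data.Integer as ℤ using (ℤ; +_; -[1+_]; _+_; _*_; -_; _-_)
import Data.Integer.Properties as ℤP
open import Algebra.Properties.CommutativeSemigroup ℤP.+-commutativeSemigroup
  using () renaming (interchange to +-interchange)
open import Relation.Binary.PropositionalEquality
open import Relation.Nullary using (Dec; yes; no)
open import Data.Sum using (inj₁; inj₂)
open import Data.Product using (_,_)
open import Data.Maybe using (Maybe; just; nothing)
open import Algebra.Bundles using (CommutativeRing)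
import Algebra.Solver.Ring.AlmostCommutativeRing as ACR
open import Level using (0ℓ)
open import Data.Empty using (⊥-elim)
open import Function using (_∘_)

sumBelow-cong : ∀ n {f g : ℕ → ℤ} → (∀ i → i <ℕ n → f i ≡ g i) → sumBelow n f ≡ sumBelow n g
sumBelow-cong zero    eq = refl
sumBelow-cong (suc n) eq =
  cong₂ _+_ (sumBelow-cong n (λ i i<n → eq i (ℕP.m<n⇒m<1+n i<n))) (eq n ℕP.≤-refl)

sumBelow-zero : ∀ n {f : ℕ → ℤ} → (∀ i → i <ℕ n → f i ≡ + 0) → sumBelow n f ≡ + 0
sumBelow-zero zero    _  = refl
sumBelow-zero (suc n) f0 =
  cong₂ _+_ (sumBelow-zero n (λ i i<n → f0 i (ℕP.m<n⇒m<1+n i<n))) (f0 n ℕP.≤-refl)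

sumBelow-+ : ∀ n (f g : ℕ → ℤ) → sumBelow n (λ i → f i + g i) ≡ sumBelow n f + sumBelow n g
sumBelow-+ zero    f g = refl
sumBelow-+ (suc n) f g =
  trans (cong (_+ (f n + g n)) (sumBelow-+ n f g)) (+-interchange (sumBelow n f) (sumBelow n g) (f n) (g n))

*-distribˡ-sumBelow : ∀ n c (f : ℕ → ℤ) → c * sumBelow n f ≡ sumBelow n (λ i → c * f i)
*-distribˡ-sumBelow zero    c f = ℤP.*-zeroʳ c
*-distribˡ-sumBelow (suc n) c f =
  trans (ℤP.*-distribˡ-+ c (sumBelow n f) (f n)) (cong (_+ c * f n) (*-distribˡ-sumBelow n c f))

*-distribʳ-sumBelow : ∀ n c (f : ℕ → ℤ) → sumBelow n f * c ≡ sumBelow n (λ i → f i * c)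
*-distribʳ-sumBelow n c f = begin
  sumBelow n f * c                ≡⟨ ℤP.*-comm (sumBelow n f) c ⟩
  c * sumBelow n f                ≡⟨ *-distribˡ-sumBelow n c f ⟩
  sumBelow n (λ i → c * f i)      ≡⟨ sumBelow-cong n (λ i _ → ℤP.*-comm c (f i)) ⟩
  sumBelow n (λ i → f i * c)      ∎
  where open ≡-Reasoning

sumBelow-suc : ∀ n (f : ℕ → ℤ) → sumBelow (suc n) f ≡ f 0 + sumBelow n (λ i → f (suc i))
sumBelow-suc zero    f = trans (ℤP.+-identityˡ (f 0)) (sym (ℤP.+-identityʳ (f 0)))
sumBelow-suc (suc n) f =
  trans (cong (_+ f (suc n)) (sumBelow-suc n f)) (ℤP.+-assoc (f 0) _ (f (suc n)))

sumBelow-pad : ∀ n m (f : ℕ → ℤ) → (∀ i → n ≤ℕ i → f i ≡ + 0) → sumBelow (n +ℕ m) f ≡ sumBelow n f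
sumBelow-pad n zero    f f0 = cong (λ k → sumBelow k f) (ℕP.+-identityʳ n)
sumBelow-pad n (suc m) f f0 = begin
  sumBelow (n +ℕ suc m) f            ≡⟨ cong (λ k → sumBelow k f) (ℕP.+-suc n m) ⟩
  sumBelow (n +ℕ m) f + f (n +ℕ m)   ≡⟨ cong₂ _+_ (sumBelow-pad n m f f0) (f0 (n +ℕ m) (ℕP.m≤m+n n m)) ⟩
  sumBelow n f + + 0                 ≡⟨ ℤP.+-identityʳ _ ⟩
  sumBelow n f                       ∎
  where open ≡-Reasoning

sumBelow-reverse : ∀ n (f : ℕ → ℤ) → sumBelow n f ≡ sumBelow n (λ i → f (n ∸ suc i))
sumBelow-reverse zero    f = refl
sumBelow-reverse (suc n) f = begin
  sumBelow n f + f n                        ≡⟨ cong (_+ f n) (sumBelow-reverse n f) ⟩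
  sumBelow n (λ i → f (n ∸ suc i)) + f n    ≡⟨ ℤP.+-comm _ (f n) ⟩
  f n + sumBelow n (λ i → f (n ∸ suc i))    ≡⟨ sumBelow-suc n (λ i → f (n ∸ i)) ⟨
  sumBelow (suc n) (λ i → f (suc n ∸ suc i)) ∎
  where open ≡-Reasoning

sumBelow-single : ∀ n a (f : ℕ → ℤ) → (∀ i → i ≢ a → f i ≡ + 0) → a <ℕ n → sumBelow n f ≡ f a
sumBelow-single (suc n) a f f0 a<1+n with a ℕ.≟ n
... | yes refl = trans (cong (_+ f a) (sumBelow-zero n (λ i i<n → f0 i (ℕP.<⇒≢ i<n))))
                       (ℤP.+-identityˡ (f a))
... | no a≢n   = trans (cong₂ _+_ (sumBelow-single n a f f0 (ℕP.≤∧≢⇒< (ℕP.≤-pred a<1+n) a≢n))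
                                  (f0 n (a≢n ∘ sym)))
                       (ℤP.+-identityʳ (f a))

sumBelow-triangle : ∀ n (F : ℕ → ℕ → ℤ) →
  sumBelow (suc n) (λ i → sumBelow (suc i) (λ j → F j i)) ≡
  sumBelow (suc n) (λ j → sumBelow (suc (n ∸ j)) (λ k → F j (j +ℕ k)))
sumBelow-triangle zero    F = refl
sumBelow-triangle (suc n) F = begin
  columns n + (column (suc n) + F (suc n) (suc n)) ≡⟨ cong (_+ (column (suc n) + F (suc n) (suc n))) (sumBelow-triangle n F) ⟩
  rows n + (column (suc n) + F (suc n) (suc n))   ≡⟨ ℤP.+-assoc (rows n) _ _ ⟨
  rows n + column (suc n) + F (suc n) (suc n)     ≡⟨ cong₂ _+_ extendRows lastRow ⟨
  rows (suc n)                                    ∎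
  where
  open ≡-Reasoning
  row : ℕ → ℕ → ℤ
  row m j = sumBelow (suc (m ∸ j)) (λ k → F j (j +ℕ k))
  rows : ℕ → ℤ
  rows m = sumBelow (suc m) (row m)
  columns : ℕ → ℤ
  columns m = sumBelow (suc m) (λ i → sumBelow (suc i) (λ j → F j i))
  column : ℕ → ℤ
  column i = sumBelow i (λ j → F j i)
  extendRow : ∀ j → j <ℕ suc n → row (suc n) j ≡ row n j + F j (suc n)
  extendRow j (s≤s j≤n) rewrite ℕP.+-∸-assoc 1 j≤n =
    cong (λ k → row n j + F j k) (trans (ℕP.+-suc j (n ∸ j)) (cong suc (ℕP.m+[n∸m]≡n j≤n)))
  extendRows : sumBelow (suc n) (row (suc n)) ≡ rows n + sumBelow (suc n) (λ j → F j (suc n))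
  extendRows = trans (sumBelow-cong (suc n) extendRow) (sumBelow-+ (suc n) (row n) (λ j → F j (suc n)))
  lastRow : row (suc n) (suc n) ≡ F (suc n) (suc n)
  lastRow rewrite ℕP.n∸n≡0 n | ℕP.+-identityʳ (suc n) = ℤP.+-identityˡ _

infix 4 _≐_ _≋[_]_

_≐_ : PS → PS → Set
f ≐ g = ∀ n → f n ≡ g n

_≋[_]_ : PS → ℕ → PS → Set
f ≋[ K ] g = ∀ n → n <ℕ K → f n ≡ g n

neg : PS → PS
neg f n = - f n

⊛-comm : ∀ f g → f ⊛ g ≐ g ⊛ f
⊛-comm f g n = begin
  sumBelow (suc n) (λ i → f i * g (n ∸ i))             ≡⟨ sumBelow-reverse (suc n) _ ⟩
  sumBelow (suc n) (λ i → f (n ∸ i) * g (n ∸ (n ∸ i))) ≡⟨ sumBelow-cong (suc n) swap ⟩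
  sumBelow (suc n) (λ i → g i * f (n ∸ i))             ∎
  where
  open ≡-Reasoning
  swap : ∀ i → i <ℕ suc n → f (n ∸ i) * g (n ∸ (n ∸ i)) ≡ g i * f (n ∸ i)
  swap i (s≤s i≤n) rewrite ℕP.m∸[m∸n]≡n i≤n = ℤP.*-comm (f (n ∸ i)) (g i)

⊛-assoc : ∀ f g h → (f ⊛ g) ⊛ h ≐ f ⊛ (g ⊛ h)
⊛-assoc f g h n = begin
  sumBelow (suc n) (λ i → sumBelow (suc i) (λ j → f j * g (i ∸ j)) * h (n ∸ i))
    ≡⟨ sumBelow-cong (suc n) (λ i _ → *-distribʳ-sumBelow (suc i) (h (n ∸ i)) _) ⟩
  sumBelow (suc n) (λ i → sumBelow (suc i) (λ j → f j * g (i ∸ j) * h (n ∸ i)))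
    ≡⟨ sumBelow-triangle n (λ j i → f j * g (i ∸ j) * h (n ∸ i)) ⟩
  sumBelow (suc n) (λ j → sumBelow (suc (n ∸ j)) (λ k → f j * g (j +ℕ k ∸ j) * h (n ∸ (j +ℕ k))))
    ≡⟨ sumBelow-cong (suc n) (λ j _ → sumBelow-cong (suc (n ∸ j)) (λ k _ → reindex j k)) ⟩
  sumBelow (suc n) (λ j → sumBelow (suc (n ∸ j)) (λ k → f j * (g k * h (n ∸ j ∸ k))))
    ≡⟨ sumBelow-cong (suc n) (λ j _ → *-distribˡ-sumBelow (suc (n ∸ j)) (f j) _) ⟨
  sumBelow (suc n) (λ j → f j * sumBelow (suc (n ∸ j)) (λ k → g k * h (n ∸ j ∸ k))) ∎
  where
  open ≡-Reasoning
  reindex : ∀ j k → f j * g (j +ℕ k ∸ j) * h (n ∸ (j +ℕ k)) ≡ f j * (g k * h (n ∸ j ∸ k))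
  reindex j k rewrite ℕP.m+n∸m≡n j k | ℕP.∸-+-assoc n j k = ℤP.*-assoc (f j) (g k) _

⊛-identityˡ : ∀ f → 1ₚ ⊛ f ≐ f
⊛-identityˡ f n = begin
  sumBelow (suc n) (λ i → 1ₚ i * f (n ∸ i))             ≡⟨ sumBelow-suc n _ ⟩
  + 1 * f n + sumBelow n (λ i → + 0 * f (n ∸ suc i))    ≡⟨ cong₂ _+_ (ℤP.*-identityˡ (f n)) (sumBelow-zero n (λ _ _ → refl)) ⟩
  f n + + 0                                             ≡⟨ ℤP.+-identityʳ (f n) ⟩
  f n                                                   ∎
  where open ≡-Reasoning

⊛-identityʳ : ∀ f → f ⊛ 1ₚ ≐ f
⊛-identityʳ f n = trans (⊛-comm f 1ₚ n) (⊛-identityˡ f n)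

⊛-distribˡ : ∀ f g h → f ⊛ (g ⊕ h) ≐ f ⊛ g ⊕ f ⊛ h
⊛-distribˡ f g h n =
  trans (sumBelow-cong (suc n) (λ i _ → ℤP.*-distribˡ-+ (f i) (g (n ∸ i)) (h (n ∸ i)))) (sumBelow-+ (suc n) _ _)

⊛-distribʳ : ∀ f g h → (g ⊕ h) ⊛ f ≐ g ⊛ f ⊕ h ⊛ f
⊛-distribʳ f g h n =
  trans (⊛-comm (g ⊕ h) f n) (trans (⊛-distribˡ f g h n) (cong₂ _+_ (⊛-comm f g n) (⊛-comm f h n)))

⊛-zeroʳ : ∀ f → f ⊛ 0ₚ ≐ 0ₚ
⊛-zeroʳ f n = sumBelow-zero (suc n) (λ i _ → ℤP.*-zeroʳ (f i))

⊛-cong-≋ : ∀ {K f f′ g g′} → f ≋[ K ] f′ → g ≋[ K ] g′ → f ⊛ g ≋[ K ] f′ ⊛ g′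
⊛-cong-≋ f≋f′ g≋g′ n n<K = sumBelow-cong (suc n) λ i i≤n →
  cong₂ _*_ (f≋f′ i (ℕP.≤-<-trans (ℕP.≤-pred i≤n) n<K)) (g≋g′ (n ∸ i) (ℕP.≤-<-trans (ℕP.m∸n≤m n i) n<K))

⊛-cong-≐ : ∀ {f f′ g g′} → f ≐ f′ → g ≐ g′ → f ⊛ g ≐ f′ ⊛ g′
⊛-cong-≐ f≐f′ g≐g′ n = ⊛-cong-≋ (λ i _ → f≐f′ i) (λ i _ → g≐g′ i) n ℕP.≤-refl

⊛-≋0 : ∀ a b {f g} → f ≋[ a ] 0ₚ → g ≋[ b ] 0ₚ → f ⊛ g ≋[ a +ℕ b ] 0ₚ
⊛-≋0 a b {f} {g} f≋0 g≋0 n n<a+b = sumBelow-zero (suc n) term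
  where
  term : ∀ i → i <ℕ suc n → f i * g (n ∸ i) ≡ + 0
  term i i≤n with i ℕ.<? a
  ... | yes i<a = cong (_* g (n ∸ i)) (f≋0 i i<a)
  ... | no  i≮a = trans (cong (f i *_) (g≋0 (n ∸ i) n∸i<b)) (ℤP.*-zeroʳ (f i))
    where
    n∸i<b : n ∸ i <ℕ b
    n∸i<b = ℕP.+-cancelˡ-< i (n ∸ i) b
      (subst (_<ℕ i +ℕ b) (sym (ℕP.m+[n∸m]≡n (ℕP.≤-pred i≤n)))
             (ℕP.<-≤-trans n<a+b (ℕP.+-monoˡ-≤ b (ℕP.≮⇒≥ i≮a))))

^ₚ-≋0 : ∀ {h} → h ≋[ 1 ] 0ₚ → ∀ k → h ^ₚ k ≋[ k ] 0ₚ
^ₚ-≋0 h≋0 zero    n ()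
^ₚ-≋0 h≋0 (suc k) = ⊛-≋0 1 k h≋0 (^ₚ-≋0 h≋0 k)

qpow-≢ : ∀ {a i} → a ≢ i → qpow a i ≡ + 0
qpow-≢ {a} {i} a≢i with a ℕ.≟ i
... | yes a≡i = ⊥-elim (a≢i a≡i)
... | no  _   = refl

qpow-refl : ∀ a → qpow a a ≡ + 1
qpow-refl a with a ℕ.≟ a
... | yes _   = refl
... | no  a≢a = ⊥-elim (a≢a refl)

qpow-zero : qpow 0 ≐ 1ₚ
qpow-zero zero    = refl
qpow-zero (suc n) = qpow-≢ {0} {suc n} (λ ())

qpow-< : ∀ {a n} → n <ℕ a → qpow a n ≡ + 0
qpow-< n<a = qpow-≢ (λ { refl → ℕP.<-irrefl refl n<a })

qpow-≋0 : ∀ {K k} → K ≤ℕ k → qpow k ≋[ K ] 0ₚ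
qpow-≋0 K≤k n n<K = qpow-< (ℕP.<-≤-trans n<K K≤k)

qpow-⊛-≥ : ∀ a f n → a ≤ℕ n → (qpow a ⊛ f) n ≡ f (n ∸ a)
qpow-⊛-≥ a f n a≤n = trans
  (sumBelow-single (suc n) a _ (λ i i≢a → cong (_* f (n ∸ i)) (qpow-≢ (i≢a ∘ sym))) (s≤s a≤n))
  (trans (cong (_* f (n ∸ a)) (qpow-refl a)) (ℤP.*-identityˡ _))

qpow-⊛-< : ∀ a f n → n <ℕ a → (qpow a ⊛ f) n ≡ + 0
qpow-⊛-< a f n n<a =
  sumBelow-zero (suc n) (λ i i≤n → cong (_* f (n ∸ i)) (qpow-< (ℕP.≤-<-trans (ℕP.≤-pred i≤n) n<a)))

qpow-+ : ∀ a b → qpow a ⊛ qpow b ≐ qpow (a +ℕ b)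
qpow-+ a b n with a ℕ.≤? n
... | no  a≰n = trans (qpow-⊛-< a (qpow b) n (ℕP.≰⇒> a≰n))
                      (sym (qpow-< (ℕP.<-≤-trans (ℕP.≰⇒> a≰n) (ℕP.m≤m+n a b))))
... | yes a≤n = trans (qpow-⊛-≥ a (qpow b) n a≤n) (lemma (a +ℕ b ℕ.≟ n))
  where
  lemma : Dec (a +ℕ b ≡ n) → qpow b (n ∸ a) ≡ qpow (a +ℕ b) n
  lemma (yes refl) = trans (cong (qpow b) (ℕP.m+n∸m≡n a b)) (trans (qpow-refl b) (sym (qpow-refl (a +ℕ b))))
  lemma (no a+b≢n) = trans (qpow-≢ (λ b≡n∸a → a+b≢n (trans (cong (a +ℕ_) b≡n∸a) (ℕP.m+[n∸m]≡n a≤n))))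
                           (sym (qpow-≢ a+b≢n))

qpow-^ₚ : ∀ a k → qpow a ^ₚ k ≐ qpow (k ℕ.* a)
qpow-^ₚ a zero    zero    = refl
qpow-^ₚ a zero    (suc n) = refl
qpow-^ₚ a (suc k) n = trans (⊛-cong-≐ {qpow a} (λ _ → refl) (qpow-^ₚ a k) n) (qpow-+ a (k ℕ.* a) n)

qpow-shift-≋ : ∀ k {a f g} → f ≋[ a ] g → qpow k ⊛ f ≋[ k +ℕ a ] qpow k ⊛ g
qpow-shift-≋ k {a} {f} {g} f≋g n n<k+a with k ℕ.≤? n
... | yes k≤n = trans (qpow-⊛-≥ k f n k≤n) (trans (f≋g (n ∸ k) n∸k<a) (sym (qpow-⊛-≥ k g n k≤n)))
  where
  n∸k<a : n ∸ k <ℕ a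
  n∸k<a = ℕP.+-cancelˡ-< k (n ∸ k) a (subst (_<ℕ k +ℕ a) (sym (ℕP.m+[n∸m]≡n k≤n)) n<k+a)
... | no  k≰n = trans (qpow-⊛-< k f n (ℕP.≰⇒> k≰n)) (sym (qpow-⊛-< k g n (ℕP.≰⇒> k≰n)))

-- The commutative ring ℤ[q]/(q^K)

constAt : ℤ → PS
constAt c zero    = c
constAt c (suc _) = + 0

-- Matching on 0 and 1 makes the solver's constants 0 and 1 denote 0ₚ and 1ₚ definitionally,
-- so that its results apply verbatim to series written with 0ₚ and 1ₚ.
constₚ : ℤ → PS
constₚ (+ 0) = 0ₚ
constₚ (+ 1) = 1ₚ
constₚ c     = constAt c

constₚ≐constAt : ∀ c → constₚ c ≐ constAt c
constₚ≐constAt (+ 0)           zero    = refl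
constₚ≐constAt (+ 0)           (suc n) = refl
constₚ≐constAt (+ 1)           zero    = refl
constₚ≐constAt (+ 1)           (suc n) = refl
constₚ≐constAt (+ suc (suc m)) n       = refl
constₚ≐constAt -[1+ m ]        n       = refl

constAt-⊛ : ∀ c f n → (constAt c ⊛ f) n ≡ c * f n
constAt-⊛ c f n = begin
  (constAt c ⊛ f) n                                           ≡⟨ sumBelow-suc n _ ⟩
  c * f n + sumBelow n (λ i → + 0 * f (n ∸ suc i))            ≡⟨ cong (λ s → c * f n + s) (sumBelow-zero n (λ _ _ → refl)) ⟩
  c * f n + + 0                                               ≡⟨ ℤP.+-identityʳ _ ⟩
  c * f n                                                     ∎
  where open ≡-Reasoning

constAt-* : ∀ a b → constAt (a * b) ≐ constAt a ⊛ constAt b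
constAt-* a b zero    = sym (constAt-⊛ a (constAt b) zero)
constAt-* a b (suc n) = sym (trans (constAt-⊛ a (constAt b) (suc n)) (ℤP.*-zeroʳ a))

constAt-+ : ∀ a b → constAt (a + b) ≐ constAt a ⊕ constAt b
constAt-+ a b zero    = refl
constAt-+ a b (suc n) = refl

constAt-neg : ∀ a → constAt (- a) ≐ neg (constAt a)
constAt-neg a zero    = refl
constAt-neg a (suc n) = refl

geometric : PS → ℕ → PS
geometric h zero    = 0ₚ
geometric h (suc M) = geometric h M ⊕ h ^ₚ M

module Trunc (K : ℕ) where

  -- Equality in ℤ[q]/(q^K).  A record, so that f and g can be read off from a proof of f ≈ g.
  record _≈_ (f g : PS) : Set where
    constructor ≋⇒≈
    field ≈⇒≋ : f ≋[ K ] g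
  open _≈_ public

  infix 4 _≈_

  ≐⇒≈ : ∀ {f g} → f ≐ g → f ≈ g
  ≐⇒≈ f≐g = ≋⇒≈ (λ n _ → f≐g n)

  ≡⇒≈ : ∀ {f g} → f ≡ g → f ≈ g
  ≡⇒≈ refl = ≐⇒≈ (λ _ → refl)

  ≈-refl : ∀ {f} → f ≈ f
  ≈-refl = ≡⇒≈ refl

  ≈-sym : ∀ {f g} → f ≈ g → g ≈ f
  ≈-sym (≋⇒≈ e) = ≋⇒≈ (λ n n<K → sym (e n n<K))

  ≈-trans : ∀ {f g h} → f ≈ g → g ≈ h → f ≈ h
  ≈-trans (≋⇒≈ e) (≋⇒≈ e′) = ≋⇒≈ (λ n n<K → trans (e n n<K) (e′ n n<K))

  ⊕-cong : ∀ {f f′ g g′} → f ≈ f′ → g ≈ g′ → f ⊕ g ≈ f′ ⊕ g′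
  ⊕-cong (≋⇒≈ e) (≋⇒≈ e′) = ≋⇒≈ (λ n n<K → cong₂ _+_ (e n n<K) (e′ n n<K))

  neg-cong : ∀ {f f′} → f ≈ f′ → neg f ≈ neg f′
  neg-cong (≋⇒≈ e) = ≋⇒≈ (λ n n<K → cong -_ (e n n<K))

  ⊛-cong : ∀ {f f′ g g′} → f ≈ f′ → g ≈ g′ → f ⊛ g ≈ f′ ⊛ g′
  ⊛-cong (≋⇒≈ e) (≋⇒≈ e′) = ≋⇒≈ (⊛-cong-≋ e e′)

  ring : CommutativeRing 0ℓ 0ℓ
  ring = record
    { Carrier = PS ; _≈_ = _≈_ ; _+_ = _⊕_ ; _*_ = _⊛_ ; -_ = neg ; 0# = 0ₚ ; 1# = 1ₚ
    ; isCommutativeRing = record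
      { isRing = record
        { +-isAbelianGroup = record
          { isGroup = record
            { isMonoid = record
              { isSemigroup = record
                { isMagma = record
                  { isEquivalence = record { refl = ≈-refl ; sym = ≈-sym ; trans = ≈-trans }
                  ; ∙-cong = ⊕-cong }
                ; assoc = λ f g h → ≐⇒≈ (λ n → ℤP.+-assoc (f n) (g n) (h n)) }
              ; identity = (λ f → ≐⇒≈ (λ n → ℤP.+-identityˡ (f n))) , (λ f → ≐⇒≈ (λ n → ℤP.+-identityʳ (f n))) }
            ; inverse = (λ f → ≐⇒≈ (λ n → ℤP.+-inverseˡ (f n))) , (λ f → ≐⇒≈ (λ n → ℤP.+-inverseʳ (f n)))
            ; ⁻¹-cong = neg-cong }
          ; comm = λ f g → ≐⇒≈ (λ n → ℤP.+-comm (f n) (g n)) }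
        ; *-cong = ⊛-cong
        ; *-assoc = λ f g h → ≐⇒≈ (⊛-assoc f g h)
        ; *-identity = (λ f → ≐⇒≈ (⊛-identityˡ f)) , (λ f → ≐⇒≈ (⊛-identityʳ f))
        ; distrib = (λ f g h → ≐⇒≈ (⊛-distribˡ f g h)) , (λ f g h → ≐⇒≈ (⊛-distribʳ f g h)) }
      ; *-comm = λ f g → ≐⇒≈ (⊛-comm f g) } }

  private
    almostCommutativeRing : ACR.AlmostCommutativeRing 0ℓ 0ℓ
    almostCommutativeRing = ACR.fromCommutativeRing ring

    viaConstAt : ∀ {f g h k} → f ≐ g → h ≐ k → g ≐ k → f ≈ h
    viaConstAt f≐g h≐k g≐k = ≐⇒≈ (λ n → trans (f≐g n) (trans (g≐k n) (sym (h≐k n))))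

    constₚ-homomorphism : CommutativeRing.rawRing ℤP.+-*-commutativeRing ACR.-Raw-AlmostCommutative⟶ almostCommutativeRing
    constₚ-homomorphism = record
      { ⟦_⟧    = constₚ
      ; +-homo = λ a b → viaConstAt (constₚ≐constAt (a + b))
                           (λ n → cong₂ _+_ (constₚ≐constAt a n) (constₚ≐constAt b n)) (constAt-+ a b)
      ; *-homo = λ a b → viaConstAt (constₚ≐constAt (a * b))
                           (⊛-cong-≐ (constₚ≐constAt a) (constₚ≐constAt b)) (constAt-* a b)
      ; -‿homo = λ a → viaConstAt (constₚ≐constAt (- a)) (λ n → cong -_ (constₚ≐constAt a n)) (constAt-neg a)
      ; 0-homo = ≈-refl
      ; 1-homo = ≈-refl }

    constₚ-≟ : ∀ a b → Maybe (constₚ a ≈ constₚ b)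
    constₚ-≟ a b with a ℤ.≟ b
    ... | yes refl = just ≈-refl
    ... | no  _    = nothing

  open import Algebra.Solver.Ring (CommutativeRing.rawRing ℤP.+-*-commutativeRing)
    almostCommutativeRing constₚ-homomorphism constₚ-≟ public
  open import Relation.Binary.Reasoning.Setoid (CommutativeRing.setoid ring) public

  :0 :1 : ∀ {m} → Polynomial m
  :0 = con (+ 0)
  :1 = con (+ 1)

  ⊛-congˡ : ∀ f {g g′} → g ≈ g′ → f ⊛ g ≈ f ⊛ g′
  ⊛-congˡ f = ⊛-cong (≈-refl {f})

  ⊛-congʳ : ∀ g {f f′} → f ≈ f′ → f ⊛ g ≈ f′ ⊛ g
  ⊛-congʳ g f≈f′ = ⊛-cong f≈f′ (≈-refl {g})

  ⊖-congˡ : ∀ f {g g′} → g ≈ g′ → f ⊖ g ≈ f ⊖ g′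
  ⊖-congˡ f g≈g′ = ⊕-cong (≈-refl {f}) (neg-cong g≈g′)

  ⊛-geometric : ∀ u M → u ⊛ geometric (1ₚ ⊖ u) M ≈ 1ₚ ⊖ (1ₚ ⊖ u) ^ₚ M
  ⊛-geometric u zero    = ≈-trans (≐⇒≈ (⊛-zeroʳ u)) (solve 0 (:0 := :1 :- :1) ≈-refl)
  ⊛-geometric u (suc M) = begin
    u ⊛ (geometric h M ⊕ h ^ₚ M)          ≈⟨ ≐⇒≈ (⊛-distribˡ u (geometric h M) (h ^ₚ M)) ⟩
    u ⊛ geometric h M ⊕ u ⊛ h ^ₚ M       ≈⟨ ⊕-cong (⊛-geometric u M) ≈-refl ⟩
    1ₚ ⊖ h ^ₚ M ⊕ u ⊛ h ^ₚ M             ≈⟨ solve 2 (λ U P → :1 :- P :+ U :* P := :1 :- (:1 :- U) :* P) ≈-refl u (h ^ₚ M) ⟩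
    1ₚ ⊖ h ⊛ h ^ₚ M                      ∎
    where h = 1ₚ ⊖ u

one-minus-≋0 : ∀ {u} → u 0 ≡ + 1 → 1ₚ ⊖ u ≋[ 1 ] 0ₚ
one-minus-≋0 u0 zero    _        = cong (λ c → + 1 - c) u0
one-minus-≋0 u0 (suc _) (s≤s ())

geometric-coeff : ∀ h M n → geometric h M n ≡ sumBelow M (λ k → (h ^ₚ k) n)
geometric-coeff h zero    n = refl
geometric-coeff h (suc M) n = cong (_+ (h ^ₚ M) n) (geometric-coeff h M n)

-- (1 - u)^k vanishes below q^k, so the terms with k > n do not contribute to the coefficient of q^n.
inv≋geometric : ∀ {u} → u 0 ≡ + 1 → ∀ n → inv u ≋[ suc n ] geometric (1ₚ ⊖ u) (suc n)
inv≋geometric {u} u0 n m (s≤s m≤n) = sym (begin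
  geometric h (suc n) m
    ≡⟨ geometric-coeff h (suc n) m ⟩
  sumBelow (suc n) (λ k → (h ^ₚ k) m)
    ≡⟨ cong (λ k → sumBelow (suc k) (λ k → (h ^ₚ k) m)) (ℕP.m+[n∸m]≡n m≤n) ⟨
  sumBelow (suc m +ℕ (n ∸ m)) (λ k → (h ^ₚ k) m)
    ≡⟨ sumBelow-pad (suc m) (n ∸ m) _ (λ k m<k → ^ₚ-≋0 (one-minus-≋0 u0) k m m<k) ⟩
  inv u m ∎)
  where
  open ≡-Reasoning
  h = 1ₚ ⊖ u

⊛-inv : ∀ u → u 0 ≡ + 1 → u ⊛ inv u ≐ 1ₚ
⊛-inv u u0 n = begin
  (u ⊛ inv u) n                   ≡⟨ ⊛-cong-≋ {f = u} (λ _ _ → refl) (inv≋geometric u0 n) n ℕP.≤-refl ⟩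
  (u ⊛ geometric h (suc n)) n     ≡⟨ Trunc.≈⇒≋ (Trunc.⊛-geometric (suc n) u (suc n)) n ℕP.≤-refl ⟩
  1ₚ n - (h ^ₚ suc n) n           ≡⟨ cong (λ c → 1ₚ n - c) (^ₚ-≋0 (one-minus-≋0 u0) (suc n) n ℕP.≤-refl) ⟩
  1ₚ n - + 0                      ≡⟨ ℤP.+-identityʳ (1ₚ n) ⟩
  1ₚ n                            ∎
  where
  open ≡-Reasoning
  h = 1ₚ ⊖ u

⊛-at-0 : ∀ f g → (f ⊛ g) 0 ≡ f 0 * g 0
⊛-at-0 f g = ℤP.+-identityˡ (f 0 * g 0)

prodBelow-at-0 : ∀ L F → (∀ i → F i 0 ≡ + 1) → prodBelow L F 0 ≡ + 1
prodBelow-at-0 zero    F F0 = refl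
prodBelow-at-0 (suc L) F F0 = trans (⊛-at-0 (prodBelow L F) (F L)) (cong₂ _*_ (prodBelow-at-0 L F F0) (F0 L))

sumₚ : ℕ → (ℕ → PS) → PS
sumₚ zero    F = 0ₚ
sumₚ (suc M) F = sumₚ M F ⊕ F M

sumₚ-coeff : ∀ M F n → sumₚ M F n ≡ sumBelow M (λ j → F j n)
sumₚ-coeff zero    F n = refl
sumₚ-coeff (suc M) F n = cong (_+ F M n) (sumₚ-coeff M F n)

module Series (K : ℕ) where

  open Trunc K public

  ⊛-cancelˡ : ∀ u v {f g} → u ⊛ v ≈ 1ₚ → u ⊛ f ≈ u ⊛ g → f ≈ g
  ⊛-cancelˡ u v {f} {g} u⊛v≈1 u⊛f≈u⊛g = begin
    f                 ≈⟨ ≐⇒≈ (⊛-identityˡ f) ⟨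
    1ₚ ⊛ f            ≈⟨ ⊛-congʳ f u⊛v≈1 ⟨
    (u ⊛ v) ⊛ f       ≈⟨ solve 3 (λ u v f → (u :* v) :* f := v :* (u :* f)) ≈-refl u v f ⟩
    v ⊛ (u ⊛ f)       ≈⟨ ⊛-congˡ v u⊛f≈u⊛g ⟩
    v ⊛ (u ⊛ g)       ≈⟨ solve 3 (λ u v g → v :* (u :* g) := (u :* v) :* g) ≈-refl u v g ⟩
    (u ⊛ v) ⊛ g       ≈⟨ ⊛-congʳ g u⊛v≈1 ⟩
    1ₚ ⊛ g            ≈⟨ ≐⇒≈ (⊛-identityˡ g) ⟩
    g                 ∎

  inverseʳ : ∀ u → u 0 ≡ + 1 → u ⊛ inv u ≈ 1ₚ
  inverseʳ u u0 = ≐⇒≈ (⊛-inv u u0)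

  inv-unique : ∀ u {v} → u 0 ≡ + 1 → u ⊛ v ≈ 1ₚ → inv u ≈ v
  inv-unique u u0 u⊛v≈1 = ⊛-cancelˡ u (inv u) (inverseʳ u u0) (≈-trans (inverseʳ u u0) (≈-sym u⊛v≈1))

  inv-1ₚ : inv 1ₚ ≈ 1ₚ
  inv-1ₚ = inv-unique 1ₚ refl (≐⇒≈ (⊛-identityˡ 1ₚ))

  inv-cong : ∀ {u u′} → u 0 ≡ + 1 → u′ 0 ≡ + 1 → u ≈ u′ → inv u ≈ inv u′
  inv-cong {u} {u′} u0 u′0 u≈u′ =
    ≈-sym (inv-unique u′ u′0 (≈-trans (⊛-congʳ (inv u) (≈-sym u≈u′)) (inverseʳ u u0)))

  inv-⊛ : ∀ u v → u 0 ≡ + 1 → v 0 ≡ + 1 → inv (u ⊛ v) ≈ inv u ⊛ inv v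
  inv-⊛ u v u0 v0 = inv-unique (u ⊛ v) (trans (⊛-at-0 u v) (cong₂ _*_ u0 v0)) (begin
    (u ⊛ v) ⊛ (inv u ⊛ inv v)   ≈⟨ solve 4 (λ a b c d → (a :* b) :* (c :* d) := (a :* c) :* (b :* d)) ≈-refl u v (inv u) (inv v) ⟩
    (u ⊛ inv u) ⊛ (v ⊛ inv v)   ≈⟨ ⊛-cong (inverseʳ u u0) (inverseʳ v v0) ⟩
    1ₚ ⊛ 1ₚ                     ≈⟨ ≐⇒≈ (⊛-identityˡ 1ₚ) ⟩
    1ₚ                          ∎)

  sumₚ-cong : ∀ M {F G} → (∀ i → i <ℕ M → F i ≈ G i) → sumₚ M F ≈ sumₚ M G
  sumₚ-cong zero    F≈G = ≈-refl
  sumₚ-cong (suc M) F≈G = ⊕-cong (sumₚ-cong M (λ i i<M → F≈G i (ℕP.m<n⇒m<1+n i<M))) (F≈G M ℕP.≤-refl)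

  ⊛-distrib-sumₚ : ∀ M c F → c ⊛ sumₚ M F ≈ sumₚ M (λ i → c ⊛ F i)
  ⊛-distrib-sumₚ zero    c F = ≐⇒≈ (⊛-zeroʳ c)
  ⊛-distrib-sumₚ (suc M) c F = ≈-trans (≐⇒≈ (⊛-distribˡ c (sumₚ M F) (F M))) (⊕-cong (⊛-distrib-sumₚ M c F) ≈-refl)

  sumₚ-⊕ : ∀ M F G → sumₚ M (λ i → F i ⊕ G i) ≈ sumₚ M F ⊕ sumₚ M G
  sumₚ-⊕ zero    F G = ≐⇒≈ (λ _ → refl)
  sumₚ-⊕ (suc M) F G = ≈-trans (⊕-cong (sumₚ-⊕ M F G) ≈-refl)
    (solve 4 (λ a b c d → (a :+ b) :+ (c :+ d) := (a :+ c) :+ (b :+ d)) ≈-refl (sumₚ M F) (sumₚ M G) (F M) (G M))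

  prodBelow-cong : ∀ L {F G} → (∀ i → i <ℕ L → F i ≈ G i) → prodBelow L F ≈ prodBelow L G
  prodBelow-cong zero    F≈G = ≈-refl
  prodBelow-cong (suc L) F≈G = ⊛-cong (prodBelow-cong L (λ i i<L → F≈G i (ℕP.m<n⇒m<1+n i<L))) (F≈G L ℕP.≤-refl)

  prodBelow-+ : ∀ L r F → prodBelow (L +ℕ r) F ≈ prodBelow L F ⊛ prodBelow r (λ i → F (L +ℕ i))
  prodBelow-+ L zero    F rewrite ℕP.+-identityʳ L = ≈-sym (≐⇒≈ (⊛-identityʳ (prodBelow L F)))
  prodBelow-+ L (suc r) F rewrite ℕP.+-suc L r =
    ≈-trans (⊛-congʳ (F (L +ℕ r)) (prodBelow-+ L r F))
            (≐⇒≈ (⊛-assoc (prodBelow L F) (prodBelow r (λ i → F (L +ℕ i))) (F (L +ℕ r))))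

  prodBelow-suc : ∀ L F → prodBelow (suc L) F ≈ F 0 ⊛ prodBelow L (λ i → F (suc i))
  prodBelow-suc L F = ≈-trans (prodBelow-+ 1 L F) (⊛-congʳ (prodBelow L (λ i → F (suc i))) (≐⇒≈ (⊛-identityˡ (F 0))))

  prodBelow-⊛ : ∀ L F G → prodBelow L (λ i → F i ⊛ G i) ≈ prodBelow L F ⊛ prodBelow L G
  prodBelow-⊛ zero    F G = ≈-sym (≐⇒≈ (⊛-identityˡ 1ₚ))
  prodBelow-⊛ (suc L) F G = ≈-trans (⊛-congʳ (F L ⊛ G L) (prodBelow-⊛ L F G))
    (solve 4 (λ a b c d → (a :* b) :* (c :* d) := (a :* c) :* (b :* d)) ≈-refl (prodBelow L F) (prodBelow L G) (F L) (G L))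

  prodBelow-≈1 : ∀ L F → (∀ i → i <ℕ L → F i ≈ 1ₚ) → prodBelow L F ≈ 1ₚ
  prodBelow-≈1 L F F≈1 = ≈-trans (prodBelow-cong L F≈1) (ones L)
    where
    ones : ∀ L → prodBelow L (λ _ → 1ₚ) ≈ 1ₚ
    ones zero    = ≈-refl
    ones (suc L) = ≈-trans (≐⇒≈ (⊛-identityʳ (prodBelow L (λ _ → 1ₚ)))) (ones L)

-- The finite identity

qFactor : ℕ → ℕ → PS
qFactor a i = 1ₚ ⊖ qpow (a +ℕ i)

qPoch : ℕ → ℕ → PS
qPoch a L = prodBelow L (qFactor a)

negqFactor : ℕ → PS
negqFactor i = 1ₚ ⊕ qpow (suc i)

negqPoch : ℕ → PS
negqPoch L = prodBelow L negqFactor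

negqFactor-at-0 : ∀ i → negqFactor i 0 ≡ + 1
negqFactor-at-0 i = cong (λ c → + 1 + c) (qpow-< {suc i} (s≤s z≤n))

negqPoch-at-0 : ∀ L → negqPoch L 0 ≡ + 1
negqPoch-at-0 L = prodBelow-at-0 L negqFactor negqFactor-at-0

qPoch-at-0 : ∀ a L → qPoch (suc a) L 0 ≡ + 1
qPoch-at-0 a L = prodBelow-at-0 L (qFactor (suc a)) (λ i → cong (λ c → + 1 - c) (qpow-< {suc a +ℕ i} (s≤s z≤n)))

triangular : ℕ → ℕ
triangular zero    = 0
triangular (suc n) = triangular n +ℕ suc n

-- (q;q)_N times the (n+1)-st term on the left is lhsPart N n; modulo q^(N+1), the same holds for
-- rhsPart on the right.  auxPart is the summand of the telescoping sum.
lhsPart : ℕ → ℕ → PS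
lhsPart N n = qpow (suc n) ⊛ qPoch (suc n) (N ∸ n) ⊛ inv (negqFactor n)

rhsPart : ℕ → ℕ → PS
rhsPart N n = qpow (triangular (suc n)) ⊛ qPoch (N ∸ n) (suc n) ⊛ inv (negqPoch (suc n))

auxPart : ℕ → ℕ → PS
auxPart M n = qpow (triangular n) ⊛ qPoch (M ∸ n) n ⊛ inv (negqPoch (suc n))

module FiniteIdentity (K : ℕ) where

  open Series K

  qPoch-suc : ∀ a L → qPoch a (suc L) ≈ (1ₚ ⊖ qpow a) ⊛ qPoch (suc a) L
  qPoch-suc a L = ≈-trans (prodBelow-suc L (qFactor a))
    (⊛-cong (≡⇒≈ (cong (λ m → 1ₚ ⊖ qpow m) (ℕP.+-identityʳ a)))
            (prodBelow-cong L (λ i _ → ≡⇒≈ (cong (λ m → 1ₚ ⊖ qpow m) (ℕP.+-suc a i)))))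

  qPoch-0-suc : ∀ L → qPoch 0 (suc L) ≈ 0ₚ
  qPoch-0-suc L = begin
    qPoch 0 (suc L)                 ≈⟨ qPoch-suc 0 L ⟩
    (1ₚ ⊖ qpow 0) ⊛ qPoch 1 L       ≈⟨ ⊛-congʳ (qPoch 1 L) (⊖-congˡ 1ₚ (≐⇒≈ qpow-zero)) ⟩
    (1ₚ ⊖ 1ₚ) ⊛ qPoch 1 L           ≈⟨ solve 1 (λ x → (:1 :- :1) :* x := :0) ≈-refl (qPoch 1 L) ⟩
    0ₚ                              ∎

  inv-negqPoch-suc : ∀ k → inv (negqPoch k) ≈ negqFactor k ⊛ inv (negqPoch (suc k))
  inv-negqPoch-suc k = inv-unique (negqPoch k) (negqPoch-at-0 k) (begin
    negqPoch k ⊛ (negqFactor k ⊛ inv (negqPoch (suc k)))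
      ≈⟨ ≐⇒≈ (⊛-assoc (negqPoch k) (negqFactor k) (inv (negqPoch (suc k)))) ⟨
    negqPoch (suc k) ⊛ inv (negqPoch (suc k))
      ≈⟨ inverseʳ (negqPoch (suc k)) (negqPoch-at-0 (suc k)) ⟩
    1ₚ ∎)

  -- Each step of the telescoping below is this identity, with X = q^T(k), s = q^(k+1), t = q^d,
  -- P = (q^(d+1);q)_k and f = 1/(-q;q)_(k+1).
  private
    auxStep : ∀ X s t P f →
      1ₚ ⊖ X ⊛ P ⊛ ((1ₚ ⊕ s) ⊛ f) ⊕ (1ₚ ⊕ s ⊛ t) ⊛ (X ⊛ P ⊛ f) ≈ 1ₚ ⊖ (X ⊛ s) ⊛ ((1ₚ ⊖ t) ⊛ P) ⊛ f
    auxStep = solve 5 (λ X s t P f → :1 :- X :* P :* ((:1 :+ s) :* f) :+ (:1 :+ s :* t) :* (X :* P :* f)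
                                     := :1 :- (X :* s) :* ((:1 :- t) :* P) :* f) ≈-refl

  aux-telescope : ∀ M k d → k +ℕ d ≡ M →
    (1ₚ ⊕ qpow M) ⊛ sumₚ k (auxPart M) ≈ 1ₚ ⊖ qpow (triangular k) ⊛ qPoch d k ⊛ inv (negqPoch k)
  aux-telescope M zero d _ = begin
    (1ₚ ⊕ qpow M) ⊛ 0ₚ                ≈⟨ ≐⇒≈ (⊛-zeroʳ (1ₚ ⊕ qpow M)) ⟩
    0ₚ                                ≈⟨ solve 0 (:0 := :1 :- :1 :* :1 :* :1) ≈-refl ⟩
    1ₚ ⊖ 1ₚ ⊛ 1ₚ ⊛ 1ₚ                 ≈⟨ ⊖-congˡ 1ₚ (⊛-cong (⊛-congʳ 1ₚ (≐⇒≈ qpow-zero)) inv-1ₚ) ⟨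
    1ₚ ⊖ qpow 0 ⊛ 1ₚ ⊛ inv 1ₚ         ∎
  aux-telescope M (suc k) d k+1+d≡M = begin
    (1ₚ ⊕ qpow M) ⊛ (sumₚ k (auxPart M) ⊕ auxPart M k)
      ≈⟨ ≐⇒≈ (⊛-distribˡ (1ₚ ⊕ qpow M) (sumₚ k (auxPart M)) (auxPart M k)) ⟩
    (1ₚ ⊕ qpow M) ⊛ sumₚ k (auxPart M) ⊕ (1ₚ ⊕ qpow M) ⊛ auxPart M k
      ≈⟨ ⊕-cong (aux-telescope M k (suc d) k+[1+d]≡M)
                (⊛-cong (⊕-cong (≈-refl {1ₚ}) qM≈) (≡⇒≈ (cong (λ m → X ⊛ qPoch m k ⊛ f) M∸k≡1+d))) ⟩
    1ₚ ⊖ X ⊛ qPoch (suc d) k ⊛ inv (negqPoch k) ⊕ (1ₚ ⊕ s ⊛ t) ⊛ (X ⊛ qPoch (suc d) k ⊛ f)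
      ≈⟨ ⊕-cong (⊖-congˡ 1ₚ (⊛-congˡ (X ⊛ qPoch (suc d) k) (inv-negqPoch-suc k))) ≈-refl ⟩
    1ₚ ⊖ X ⊛ qPoch (suc d) k ⊛ ((1ₚ ⊕ s) ⊛ f) ⊕ (1ₚ ⊕ s ⊛ t) ⊛ (X ⊛ qPoch (suc d) k ⊛ f)
      ≈⟨ auxStep X s t (qPoch (suc d) k) f ⟩
    1ₚ ⊖ (X ⊛ s) ⊛ ((1ₚ ⊖ t) ⊛ qPoch (suc d) k) ⊛ f
      ≈⟨ ⊖-congˡ 1ₚ (⊛-congʳ f (⊛-cong (≐⇒≈ (qpow-+ (triangular k) (suc k))) (≈-sym (qPoch-suc d k)))) ⟩
    1ₚ ⊖ qpow (triangular (suc k)) ⊛ qPoch d (suc k) ⊛ f ∎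
    where
    X = qpow (triangular k)
    s = qpow (suc k)
    t = qpow d
    f = inv (negqPoch (suc k))
    k+[1+d]≡M : k +ℕ suc d ≡ M
    k+[1+d]≡M = trans (ℕP.+-suc k d) k+1+d≡M
    M∸k≡1+d : M ∸ k ≡ suc d
    M∸k≡1+d = trans (cong (_∸ k) (sym k+[1+d]≡M)) (ℕP.m+n∸m≡n k (suc d))
    qM≈ : qpow M ≈ s ⊛ t
    qM≈ = ≈-sym (≈-trans (≐⇒≈ (qpow-+ (suc k) d)) (≡⇒≈ (cong qpow k+1+d≡M)))

  aux-sum : ∀ M → sumₚ (suc M) (auxPart (suc M)) ≈ inv (negqFactor M)
  aux-sum M = ≈-sym (inv-unique (negqFactor M) (negqFactor-at-0 M) (begin
    negqFactor M ⊛ sumₚ (suc M) (auxPart (suc M))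
      ≈⟨ aux-telescope (suc M) (suc M) 0 (ℕP.+-identityʳ (suc M)) ⟩
    1ₚ ⊖ X ⊛ qPoch 0 (suc M) ⊛ f    ≈⟨ ⊖-congˡ 1ₚ (⊛-congʳ f (⊛-congˡ X (qPoch-0-suc M))) ⟩
    1ₚ ⊖ X ⊛ 0ₚ ⊛ f                 ≈⟨ solve 2 (λ X f → :1 :- X :* :0 :* f := :1) ≈-refl X f ⟩
    1ₚ                              ∎))
    where
    X = qpow (triangular (suc M))
    f = inv (negqPoch (suc M))

  lhsPart-suc : ∀ N n → n ≤ℕ N → lhsPart (suc N) n ≈ (1ₚ ⊖ qpow (suc N)) ⊛ lhsPart N n
  lhsPart-suc N n n≤N = begin
    qpow (suc n) ⊛ qPoch (suc n) (suc N ∸ n) ⊛ f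
      ≈⟨ ⊛-congʳ f (⊛-congˡ (qpow (suc n)) (≡⇒≈ (cong (qPoch (suc n)) (ℕP.+-∸-assoc 1 n≤N)))) ⟩
    qpow (suc n) ⊛ (qPoch (suc n) (N ∸ n) ⊛ (1ₚ ⊖ qpow (suc n +ℕ (N ∸ n)))) ⊛ f
      ≈⟨ ⊛-congʳ f (⊛-congˡ (qpow (suc n)) (⊛-congˡ (qPoch (suc n) (N ∸ n))
           (≡⇒≈ (cong (λ m → 1ₚ ⊖ qpow (suc m)) (ℕP.m+[n∸m]≡n n≤N))))) ⟩
    qpow (suc n) ⊛ (qPoch (suc n) (N ∸ n) ⊛ (1ₚ ⊖ qpow (suc N))) ⊛ f
      ≈⟨ solve 4 (λ a b c d → a :* (b :* (:1 :- c)) :* d := (:1 :- c) :* (a :* b :* d)) ≈-refl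
                 (qpow (suc n)) (qPoch (suc n) (N ∸ n)) (qpow (suc N)) f ⟩
    (1ₚ ⊖ qpow (suc N)) ⊛ lhsPart N n ∎
    where f = inv (negqFactor n)

  lhsSum-suc : ∀ N → sumₚ (suc N) (lhsPart (suc N)) ≈
    (1ₚ ⊖ qpow (suc N)) ⊛ (sumₚ N (lhsPart N) ⊕ qpow (suc N) ⊛ inv (negqFactor N))
  lhsSum-suc N = begin
    sumₚ (suc N) (lhsPart (suc N))
      ≈⟨ sumₚ-cong (suc N) (λ n n<1+N → lhsPart-suc N n (ℕP.≤-pred n<1+N)) ⟩
    sumₚ (suc N) (λ n → (1ₚ ⊖ qpow (suc N)) ⊛ lhsPart N n)
      ≈⟨ ⊛-distrib-sumₚ (suc N) (1ₚ ⊖ qpow (suc N)) (lhsPart N) ⟨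
    (1ₚ ⊖ qpow (suc N)) ⊛ (sumₚ N (lhsPart N) ⊕ lhsPart N N)
      ≈⟨ ⊛-congˡ (1ₚ ⊖ qpow (suc N)) (⊕-cong (≈-refl {sumₚ N (lhsPart N)}) lastPart) ⟩
    (1ₚ ⊖ qpow (suc N)) ⊛ (sumₚ N (lhsPart N) ⊕ qpow (suc N) ⊛ inv (negqFactor N)) ∎
    where
    lastPart : lhsPart N N ≈ qpow (suc N) ⊛ inv (negqFactor N)
    lastPart = ⊛-congʳ (inv (negqFactor N))
      (≈-trans (⊛-congˡ (qpow (suc N)) (≡⇒≈ (cong (qPoch (suc N)) (ℕP.n∸n≡0 N)))) (≐⇒≈ (⊛-identityʳ (qpow (suc N)))))

  -- Splits q^T(n+1) (q^(d+1);q)_(n+1) along 1 = (1 - q^d) + q^d, where d = N - n.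
  private
    rhsStep : ∀ X s t P f → (X ⊛ s) ⊛ (P ⊛ (1ₚ ⊖ s ⊛ t)) ⊛ f ≈
      (1ₚ ⊖ s ⊛ t) ⊛ ((X ⊛ s) ⊛ ((1ₚ ⊖ t) ⊛ P) ⊛ f) ⊕ ((1ₚ ⊖ s ⊛ t) ⊛ (s ⊛ t)) ⊛ (X ⊛ P ⊛ f)
    rhsStep = solve 5 (λ X s t P f → (X :* s) :* (P :* (:1 :- s :* t)) :* f
      := (:1 :- s :* t) :* ((X :* s) :* ((:1 :- t) :* P) :* f) :+ ((:1 :- s :* t) :* (s :* t)) :* (X :* P :* f)) ≈-refl

  rhsPart-suc : ∀ N n → n ≤ℕ N → rhsPart (suc N) n ≈
    (1ₚ ⊖ qpow (suc N)) ⊛ rhsPart N n ⊕ ((1ₚ ⊖ qpow (suc N)) ⊛ qpow (suc N)) ⊛ auxPart (suc N) n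
  rhsPart-suc N n n≤N = begin
    qpow (triangular (suc n)) ⊛ qPoch (suc N ∸ n) (suc n) ⊛ f
      ≈⟨ ⊛-congʳ f (⊛-cong X⊛s≈ (≡⇒≈ (cong (λ m → qPoch m (suc n)) (sym 1+N∸n≡1+d)))) ⟨
    (X ⊛ s) ⊛ (P ⊛ (1ₚ ⊖ qpow (suc d +ℕ n))) ⊛ f
      ≈⟨ ⊛-congʳ f (⊛-congˡ (X ⊛ s) (⊛-congˡ P (⊖-congˡ 1ₚ s⊛t≈))) ⟨
    (X ⊛ s) ⊛ (P ⊛ (1ₚ ⊖ s ⊛ t)) ⊛ f
      ≈⟨ rhsStep X s t P f ⟩
    (1ₚ ⊖ s ⊛ t) ⊛ ((X ⊛ s) ⊛ ((1ₚ ⊖ t) ⊛ P) ⊛ f) ⊕ ((1ₚ ⊖ s ⊛ t) ⊛ (s ⊛ t)) ⊛ (X ⊛ P ⊛ f)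
      ≈⟨ ⊕-cong (⊛-cong 1⊖s⊛t≈ (⊛-congʳ f (⊛-cong X⊛s≈ (≈-sym (qPoch-suc d n)))))
                (⊛-cong (⊛-cong 1⊖s⊛t≈ s⊛t≈x) (≡⇒≈ (cong (λ m → X ⊛ qPoch m n ⊛ f) (sym 1+N∸n≡1+d)))) ⟩
    (1ₚ ⊖ qpow (suc N)) ⊛ rhsPart N n ⊕ ((1ₚ ⊖ qpow (suc N)) ⊛ qpow (suc N)) ⊛ auxPart (suc N) n ∎
    where
    d = N ∸ n
    X = qpow (triangular n)
    s = qpow (suc n)
    t = qpow d
    P = qPoch (suc d) n
    f = inv (negqPoch (suc n))
    1+N∸n≡1+d : suc N ∸ n ≡ suc d
    1+N∸n≡1+d = ℕP.+-∸-assoc 1 n≤N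
    X⊛s≈ : X ⊛ s ≈ qpow (triangular (suc n))
    X⊛s≈ = ≐⇒≈ (qpow-+ (triangular n) (suc n))
    s⊛t≈ : s ⊛ t ≈ qpow (suc d +ℕ n)
    s⊛t≈ = ≈-trans (≐⇒≈ (qpow-+ (suc n) d)) (≡⇒≈ (cong (qpow ∘ suc) (ℕP.+-comm n d)))
    s⊛t≈x : s ⊛ t ≈ qpow (suc N)
    s⊛t≈x = ≈-trans (≐⇒≈ (qpow-+ (suc n) d)) (≡⇒≈ (cong (qpow ∘ suc) (ℕP.m+[n∸m]≡n n≤N)))
    1⊖s⊛t≈ : 1ₚ ⊖ s ⊛ t ≈ 1ₚ ⊖ qpow (suc N)
    1⊖s⊛t≈ = ⊖-congˡ 1ₚ s⊛t≈x

  rhsPart-last : ∀ N → rhsPart N N ≈ 0ₚ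
  rhsPart-last N = begin
    X ⊛ qPoch (N ∸ N) (suc N) ⊛ f    ≈⟨ ⊛-congʳ f (⊛-congˡ X (≡⇒≈ (cong (λ m → qPoch m (suc N)) (ℕP.n∸n≡0 N)))) ⟩
    X ⊛ qPoch 0 (suc N) ⊛ f          ≈⟨ ⊛-congʳ f (⊛-congˡ X (qPoch-0-suc N)) ⟩
    X ⊛ 0ₚ ⊛ f                       ≈⟨ solve 2 (λ X f → X :* :0 :* f := :0) ≈-refl X f ⟩
    0ₚ                               ∎
    where
    X = qpow (triangular (suc N))
    f = inv (negqPoch (suc N))

  rhsSum-suc : ∀ N → sumₚ (suc N) (rhsPart (suc N)) ≈
    (1ₚ ⊖ qpow (suc N)) ⊛ sumₚ N (rhsPart N) ⊕ ((1ₚ ⊖ qpow (suc N)) ⊛ qpow (suc N)) ⊛ inv (negqFactor N)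
  rhsSum-suc N = begin
    sumₚ (suc N) (rhsPart (suc N))
      ≈⟨ sumₚ-cong (suc N) (λ n n<1+N → rhsPart-suc N n (ℕP.≤-pred n<1+N)) ⟩
    sumₚ (suc N) (λ n → a ⊛ rhsPart N n ⊕ b ⊛ auxPart (suc N) n)
      ≈⟨ sumₚ-⊕ (suc N) (λ n → a ⊛ rhsPart N n) (λ n → b ⊛ auxPart (suc N) n) ⟩
    sumₚ (suc N) (λ n → a ⊛ rhsPart N n) ⊕ sumₚ (suc N) (λ n → b ⊛ auxPart (suc N) n)
      ≈⟨ ⊕-cong (⊛-distrib-sumₚ (suc N) a (rhsPart N)) (⊛-distrib-sumₚ (suc N) b (auxPart (suc N))) ⟨
    a ⊛ (sumₚ N (rhsPart N) ⊕ rhsPart N N) ⊕ b ⊛ sumₚ (suc N) (auxPart (suc N))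
      ≈⟨ ⊕-cong (⊛-congˡ a (⊕-cong (≈-refl {sumₚ N (rhsPart N)}) (rhsPart-last N))) (⊛-congˡ b (aux-sum N)) ⟩
    a ⊛ (sumₚ N (rhsPart N) ⊕ 0ₚ) ⊕ b ⊛ inv (negqFactor N)
      ≈⟨ ⊕-cong (⊛-congˡ a (solve 1 (λ y → y :+ :0 := y) ≈-refl (sumₚ N (rhsPart N)))) ≈-refl ⟩
    a ⊛ sumₚ N (rhsPart N) ⊕ b ⊛ inv (negqFactor N) ∎
    where
    a = 1ₚ ⊖ qpow (suc N)
    b = a ⊛ qpow (suc N)

  lhsSum≈rhsSum : ∀ N → sumₚ N (lhsPart N) ≈ sumₚ N (rhsPart N)
  lhsSum≈rhsSum zero    = ≈-refl
  lhsSum≈rhsSum (suc N) = begin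
    sumₚ (suc N) (lhsPart (suc N))            ≈⟨ lhsSum-suc N ⟩
    (1ₚ ⊖ x) ⊛ (sumₚ N (lhsPart N) ⊕ x ⊛ w)    ≈⟨ ⊛-congˡ (1ₚ ⊖ x) (⊕-cong (lhsSum≈rhsSum N) (≈-refl {x ⊛ w})) ⟩
    (1ₚ ⊖ x) ⊛ (sumₚ N (rhsPart N) ⊕ x ⊛ w)
      ≈⟨ solve 3 (λ x r w → (:1 :- x) :* (r :+ x :* w) := (:1 :- x) :* r :+ ((:1 :- x) :* x) :* w) ≈-refl
                 x (sumₚ N (rhsPart N)) w ⟩
    (1ₚ ⊖ x) ⊛ sumₚ N (rhsPart N) ⊕ ((1ₚ ⊖ x) ⊛ x) ⊛ w ≈⟨ rhsSum-suc N ⟨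
    sumₚ (suc N) (rhsPart (suc N))            ∎
    where
    x = qpow (suc N)
    w = inv (negqFactor N)

triangular-*2 : ∀ n → n ℕ.* suc n ≡ triangular n ℕ.* 2
triangular-*2 zero    = refl
triangular-*2 (suc n) = begin
  suc n ℕ.* suc (suc n)                     ≡⟨ expand n ⟩
  n ℕ.* suc n +ℕ suc n ℕ.* 2                ≡⟨ cong (_+ℕ suc n ℕ.* 2) (triangular-*2 n) ⟩
  triangular n ℕ.* 2 +ℕ suc n ℕ.* 2         ≡⟨ ℕP.*-distribʳ-+ 2 (triangular n) (suc n) ⟨
  triangular (suc n) ℕ.* 2                  ∎
  where
  open ≡-Reasoning
  expand : ∀ n → suc n ℕ.* suc (suc n) ≡ n ℕ.* suc n +ℕ suc n ℕ.* 2
  expand = ℕSolver.solve-∀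

triangular-half : ∀ n → (n ℕ.* suc n) / 2 ≡ triangular n
triangular-half n = trans (cong (_/ 2) (triangular-*2 n)) (m*n/n≡m (triangular n) 2)

triangular-≥ : ∀ n → n ≤ℕ triangular n
triangular-≥ zero    = z≤n
triangular-≥ (suc n) = ℕP.m≤n+m (suc n) (triangular n)

prodBelow-cong-≐ : ∀ L {F G} → (∀ i → F i ≐ G i) → prodBelow L F ≐ prodBelow L G
prodBelow-cong-≐ zero    F≐G = λ _ → refl
prodBelow-cong-≐ (suc L) F≐G = ⊛-cong-≐ (prodBelow-cong-≐ L F≐G) (F≐G L)

poch-qpow-q : ∀ a L → poch (qpow a) q L ≐ qPoch a L
poch-qpow-q a L = prodBelow-cong-≐ L λ i n → cong (λ c → 1ₚ n - c) (begin
  (qpow a ⊛ q ^ₚ i) n            ≡⟨ ⊛-cong-≐ {qpow a} (λ _ → refl) (qpow-^ₚ 1 i) n ⟩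
  (qpow a ⊛ qpow (i ℕ.* 1)) n    ≡⟨ qpow-+ a (i ℕ.* 1) n ⟩
  qpow (a +ℕ i ℕ.* 1) n          ≡⟨ cong (λ k → qpow (a +ℕ k) n) (ℕP.*-identityʳ i) ⟩
  qpow (a +ℕ i) n                ∎)
  where open ≡-Reasoning

poch-q-q-at-0 : ∀ L → poch q q L 0 ≡ + 1
poch-q-q-at-0 L = trans (poch-qpow-q 1 L 0) (qPoch-at-0 0 L)

qFactor-≋1 : ∀ {K} a i → K ≤ℕ a +ℕ i → qFactor a i ≋[ K ] 1ₚ
qFactor-≋1 a i K≤a+i n n<K = trans (cong (λ c → 1ₚ n - c) (qpow-≋0 K≤a+i n n<K)) (ℤP.+-identityʳ (1ₚ n))

qPoch-≋1 : ∀ a L → qPoch a L ≋[ a ] 1ₚ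
qPoch-≋1 a L = ≈⇒≋ (prodBelow-≈1 L (qFactor a) (λ i _ → ≋⇒≈ (qFactor-≋1 a i (ℕP.m≤m+n a i))))
  where open Series a

qPoch-+-≋ : ∀ a L r → qPoch a (L +ℕ r) ≋[ a +ℕ L ] qPoch a L
qPoch-+-≋ a L r = ≈⇒≋ (begin
  qPoch a (L +ℕ r)                                   ≈⟨ prodBelow-+ L r (qFactor a) ⟩
  qPoch a L ⊛ prodBelow r (λ i → qFactor a (L +ℕ i)) ≈⟨ ⊛-congˡ (qPoch a L) (prodBelow-≈1 r _ tail≈1) ⟩
  qPoch a L ⊛ 1ₚ                                     ≈⟨ ≐⇒≈ (⊛-identityʳ (qPoch a L)) ⟩
  qPoch a L                                          ∎)
  where
  open Series (a +ℕ L)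
  tail≈1 : ∀ i → i <ℕ r → qFactor a (L +ℕ i) ≈ 1ₚ
  tail≈1 i _ = ≋⇒≈ (qFactor-≋1 a (L +ℕ i) (ℕP.+-monoʳ-≤ a (ℕP.m≤m+n L i)))

qPoch-stable : ∀ a {L L′ n} → n <ℕ a +ℕ L → n <ℕ a +ℕ L′ → qPoch a L n ≡ qPoch a L′ n
qPoch-stable a {L} {L′} {n} n<a+L n<a+L′ with ℕP.≤-total L L′
... | inj₁ L≤L′ = sym (trans (cong (λ m → qPoch a m n) (sym (ℕP.m+[n∸m]≡n L≤L′))) (qPoch-+-≋ a L (L′ ∸ L) n n<a+L))
... | inj₂ L′≤L = trans (cong (λ m → qPoch a m n) (sym (ℕP.m+[n∸m]≡n L′≤L))) (qPoch-+-≋ a L′ (L ∸ L′) n n<a+L′)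

pochInf-≋qPoch : ∀ N m → m ≤ℕ N → pochInf (qpow (suc m)) q ≋[ suc N ] qPoch (suc m) (N ∸ m)
pochInf-≋qPoch N m m≤N n n<1+N = trans (poch-qpow-q (suc m) (suc n) n)
  (qPoch-stable (suc m) (s≤s (ℕP.≤-trans (ℕP.n≤1+n n) (ℕP.m≤n+m (suc n) m)))
                        (subst (n <ℕ_) (cong suc (sym (ℕP.m+[n∸m]≡n m≤N))) n<1+N))

rhsPart-≋ : ∀ N n → n <ℕ N → rhsPart N n ≋[ suc N ] qpow (triangular (suc n)) ⊛ inv (negqPoch (suc n))
rhsPart-≋ N n n<N m m<1+N = trans (⊛-assoc (qpow T) (qPoch (N ∸ n) (suc n)) f m)
  (qpow-shift-≋ T qPoch⊛f≋f m (ℕP.<-≤-trans m<1+N 1+N≤T+[N∸n]))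
  where
  T = triangular (suc n)
  f = inv (negqPoch (suc n))
  qPoch⊛f≋f : qPoch (N ∸ n) (suc n) ⊛ f ≋[ N ∸ n ] f
  qPoch⊛f≋f k k<N∸n = trans (⊛-cong-≋ {g = f} (qPoch-≋1 (N ∸ n) (suc n)) (λ _ _ → refl) k k<N∸n) (⊛-identityˡ f k)
  1+N≤T+[N∸n] : suc N ≤ℕ T +ℕ (N ∸ n)
  1+N≤T+[N∸n] = subst (_≤ℕ T +ℕ (N ∸ n)) (cong suc (ℕP.m+[n∸m]≡n (ℕP.<⇒≤ n<N)))
                      (ℕP.+-monoˡ-≤ (N ∸ n) (triangular-≥ (suc n)))

module Comparison (N : ℕ) where

  open Series (suc N)
  open FiniteIdentity (suc N) using (lhsSum≈rhsSum)

  poch-q-q-split : ∀ m → m ≤ℕ N → poch q q N ≈ poch q q m ⊛ qPoch (suc m) (N ∸ m)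
  poch-q-q-split m m≤N = begin
    poch q q N                            ≈⟨ ≐⇒≈ (poch-qpow-q 1 N) ⟩
    qPoch 1 N                             ≈⟨ ≡⇒≈ (cong (qPoch 1) (ℕP.m+[n∸m]≡n m≤N)) ⟨
    qPoch 1 (m +ℕ (N ∸ m))                ≈⟨ prodBelow-+ m (N ∸ m) (qFactor 1) ⟩
    qPoch 1 m ⊛ qPoch (suc m) (N ∸ m)     ≈⟨ ⊛-congʳ (qPoch (suc m) (N ∸ m)) (≐⇒≈ (poch-qpow-q 1 m)) ⟨
    poch q q m ⊛ qPoch (suc m) (N ∸ m)    ∎

  lhsTerm-scaled : ∀ n → n <ℕ N → poch q q N ⊛ lhsTerm (suc n) ≈ lhsPart N n
  lhsTerm-scaled n n<N = begin
    Q ⊛ (x ⊛ w ⊛ inv Qn)           ≈⟨ ⊛-congʳ (x ⊛ w ⊛ inv Qn) (poch-q-q-split n (ℕP.<⇒≤ n<N)) ⟩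
    (Qn ⊛ P) ⊛ (x ⊛ w ⊛ inv Qn)
      ≈⟨ solve 5 (λ Qn P x w Qn⁻¹ → (Qn :* P) :* (x :* w :* Qn⁻¹) := x :* P :* w :* (Qn :* Qn⁻¹)) ≈-refl
                 Qn P x w (inv Qn) ⟩
    lhsPart N n ⊛ (Qn ⊛ inv Qn)    ≈⟨ ⊛-congˡ (lhsPart N n) (inverseʳ Qn (poch-q-q-at-0 n)) ⟩
    lhsPart N n ⊛ 1ₚ               ≈⟨ ≐⇒≈ (⊛-identityʳ (lhsPart N n)) ⟩
    lhsPart N n                    ∎
    where
    Q  = poch q q N
    Qn = poch q q n
    P  = qPoch (suc n) (N ∸ n)
    x  = qpow (suc n)
    w  = inv (negqFactor n)

  poch-q²-q² : ∀ m → poch (qpow 2) (qpow 2) m ≈ poch q q m ⊛ negqPoch m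
  poch-q²-q² m = begin
    poch (qpow 2) (qpow 2) m                        ≈⟨ prodBelow-cong m (λ i _ → factor i) ⟩
    prodBelow m (λ i → qFactor 1 i ⊛ negqFactor i)  ≈⟨ prodBelow-⊛ m (qFactor 1) negqFactor ⟩
    qPoch 1 m ⊛ negqPoch m                          ≈⟨ ⊛-congʳ (negqPoch m) (≐⇒≈ (poch-qpow-q 1 m)) ⟨
    poch q q m ⊛ negqPoch m                         ∎
    where
    2+i*2≡ : ∀ i → 2 +ℕ i ℕ.* 2 ≡ suc i +ℕ suc i
    2+i*2≡ = ℕSolver.solve-∀
    factor : ∀ i → 1ₚ ⊖ qpow 2 ⊛ qpow 2 ^ₚ i ≈ qFactor 1 i ⊛ negqFactor i
    factor i = begin
      1ₚ ⊖ qpow 2 ⊛ qpow 2 ^ₚ i                 ≈⟨ ⊖-congˡ 1ₚ (≐⇒≈ (⊛-cong-≐ {qpow 2} (λ _ → refl) (qpow-^ₚ 2 i))) ⟩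
      1ₚ ⊖ qpow 2 ⊛ qpow (i ℕ.* 2)              ≈⟨ ⊖-congˡ 1ₚ (≐⇒≈ (qpow-+ 2 (i ℕ.* 2))) ⟩
      1ₚ ⊖ qpow (2 +ℕ i ℕ.* 2)                  ≈⟨ ⊖-congˡ 1ₚ (≡⇒≈ (cong qpow (2+i*2≡ i))) ⟩
      1ₚ ⊖ qpow (suc i +ℕ suc i)                ≈⟨ ⊖-congˡ 1ₚ (≐⇒≈ (qpow-+ (suc i) (suc i))) ⟨
      1ₚ ⊖ qpow (suc i) ⊛ qpow (suc i)          ≈⟨ solve 1 (λ y → :1 :- y :* y := (:1 :- y) :* (:1 :+ y)) ≈-refl (qpow (suc i)) ⟩
      qFactor 1 i ⊛ negqFactor i                ∎

  denominator : ∀ m → m ≤ℕ N → poch (qpow 2) (qpow 2) m ⊛ pochInf (qpow (suc m)) q ≈ poch q q N ⊛ negqPoch m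
  denominator m m≤N = begin
    poch (qpow 2) (qpow 2) m ⊛ pochInf (qpow (suc m)) q  ≈⟨ ⊛-cong (poch-q²-q² m) (≋⇒≈ (pochInf-≋qPoch N m m≤N)) ⟩
    (Qm ⊛ negqPoch m) ⊛ P                                ≈⟨ solve 3 (λ a b c → (a :* b) :* c := (a :* c) :* b) ≈-refl Qm (negqPoch m) P ⟩
    (Qm ⊛ P) ⊛ negqPoch m                                ≈⟨ ⊛-congʳ (negqPoch m) (poch-q-q-split m m≤N) ⟨
    poch q q N ⊛ negqPoch m                              ∎
    where
    Qm = poch q q m
    P  = qPoch (suc m) (N ∸ m)

  rhsTerm-scaled : ∀ n → n <ℕ N → poch q q N ⊛ rhsTerm (suc n) ≈ rhsPart N n
  rhsTerm-scaled n n<N = begin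
    Q ⊛ (qpow ((suc n ℕ.* suc (suc n)) / 2) ⊛ inv D)
      ≈⟨ ⊛-congˡ Q (⊛-cong (≡⇒≈ (cong qpow (triangular-half (suc n)))) (inv-cong D0 QE0 (denominator (suc n) n<N))) ⟩
    Q ⊛ (x ⊛ inv (Q ⊛ E))
      ≈⟨ ⊛-congˡ Q (⊛-congˡ x (inv-⊛ Q E (poch-q-q-at-0 N) (negqPoch-at-0 (suc n)))) ⟩
    Q ⊛ (x ⊛ (inv Q ⊛ inv E))
      ≈⟨ solve 4 (λ Q x Q⁻¹ E⁻¹ → Q :* (x :* (Q⁻¹ :* E⁻¹)) := (x :* E⁻¹) :* (Q :* Q⁻¹)) ≈-refl Q x (inv Q) (inv E) ⟩
    (x ⊛ inv E) ⊛ (Q ⊛ inv Q)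
      ≈⟨ ⊛-congˡ (x ⊛ inv E) (inverseʳ Q (poch-q-q-at-0 N)) ⟩
    (x ⊛ inv E) ⊛ 1ₚ
      ≈⟨ ≐⇒≈ (⊛-identityʳ (x ⊛ inv E)) ⟩
    x ⊛ inv E
      ≈⟨ ≋⇒≈ (rhsPart-≋ N n n<N) ⟨
    rhsPart N n ∎
    where
    Q = poch q q N
    E = negqPoch (suc n)
    x = qpow (triangular (suc n))
    D = poch (qpow 2) (qpow 2) (suc n) ⊛ pochInf (qpow (suc (suc n))) q
    QE0 : (Q ⊛ E) 0 ≡ + 1
    QE0 = trans (⊛-at-0 Q E) (cong₂ _*_ (poch-q-q-at-0 N) (negqPoch-at-0 (suc n)))
    D0 : D 0 ≡ + 1
    D0 = trans (≈⇒≋ (denominator (suc n) n<N) 0 (s≤s z≤n)) QE0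

  lhsSeries≈rhsSeries : sumₚ N (lhsTerm ∘ suc) ≈ sumₚ N (rhsTerm ∘ suc)
  lhsSeries≈rhsSeries = ⊛-cancelˡ Q (inv Q) (inverseʳ Q (poch-q-q-at-0 N)) (begin
    Q ⊛ sumₚ N (lhsTerm ∘ suc)               ≈⟨ ⊛-distrib-sumₚ N Q (lhsTerm ∘ suc) ⟩
    sumₚ N (λ n → Q ⊛ lhsTerm (suc n))       ≈⟨ sumₚ-cong N lhsTerm-scaled ⟩
    sumₚ N (lhsPart N)                       ≈⟨ lhsSum≈rhsSum N ⟩
    sumₚ N (rhsPart N)                       ≈⟨ sumₚ-cong N rhsTerm-scaled ⟨
    sumₚ N (λ n → Q ⊛ rhsTerm (suc n))       ≈⟨ ⊛-distrib-sumₚ N Q (rhsTerm ∘ suc) ⟨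
    Q ⊛ sumₚ N (rhsTerm ∘ suc)               ∎)
    where Q = poch q q N

theorem3p2 : (N : ℕ) → sumFrom1 lhsTerm N ≡ sumFrom1 rhsTerm N
theorem3p2 N = begin
  sumFrom1 lhsTerm N            ≡⟨ sumₚ-coeff N (lhsTerm ∘ suc) N ⟨
  sumₚ N (lhsTerm ∘ suc) N      ≡⟨ Series.≈⇒≋ (Comparison.lhsSeries≈rhsSeries N) N ℕP.≤-refl ⟩
  sumₚ N (rhsTerm ∘ suc) N      ≡⟨ sumₚ-coeff N (rhsTerm ∘ suc) N ⟩
  sumFrom1 rhsTerm N            ∎
  where open ≡-Reasoning
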